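{- For all positive integers $n$ and $N$: (i) if $f(N)\le n$, then $F(n)\ge N$; (ii) if $f(N)>n$, then $F(n)<N$; and (iii) $F(n)=N$ if and only if $f(N)=n$ and $f(N+1)>n$.
   Context: The transitive tournament on $N$ vertices has vertex set $\{1,\ldots,N\}$ with each edge between $i<j$ oriented from $i$ to $j$. A directed path in it is a sequence of vertices $v_1<\cdots<v_m$ (using edges $\overrightarrow{v_sv_{s+1}}$), and its vertex-length is $m$. For a positive integer $N$, $f(N)$ is the maximum number such that every coloring of the edges of the transitive $N$-vertex tournament with three colors contains a directed path of vertex-length at least $f(N)$ which avoids at least one of the colors. For a positive integer $n$, $F(n)$ is the maximum length of a sequence of triples $L_1,L_2,\ldots$ with all coordinates integers between $1$ and $n$ inclusive, such that for every $i<j$ there are at least two coordinates in which $L_i$ is strictly less than $L_j$. -}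

module Defs where

open import Data.Nat using (ℕ; _≤_; _<_)
open import Data.Fin using (Fin) renaming (_<_ to _<ᶠ_)
open import Data.List using (List; length)
open import Data.List.Relation.Unary.Linked using (Linked)
open import Data.List.Relation.Unary.AllPairs using (AllPairs)
open import Data.Product using (Σ; ∃; _×_; _,_)
open import Data.Sum using (_⊎_)
open import Relation.Binary.PropositionalEquality using (_≡_; _≢_)

IsMaximum : (ℕ → Set) → ℕ → Set
IsMaximum P m = P m × (∀ k → P k → k ≤ m)

-- A 3-colouring of the edges of the transitive tournament on N vertices
-- (vertices Fin N = {0,…,N-1}, edge i→j for i<j).  Only the values
-- col i j with i < j are ever consulted.
Colouring : ℕ → Set
Colouring N = Fin N → Fin N → Fin 3

Step : ∀ {N} → Colouring N → Fin 3 → Fin N → Fin N → Set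
Step col c x y = (x <ᶠ y) × (col x y ≢ c)

AvoidingPath : ∀ {N} → Colouring N → Fin 3 → List (Fin N) → Set
AvoidingPath col c = Linked (Step col c)

fProperty : ℕ → ℕ → Set
fProperty N m = ∀ (col : Colouring N) →
  Σ (Fin 3) λ c → Σ (List (Fin N)) λ p → AvoidingPath col c p × m ≤ length p

IsF : ℕ → ℕ → Set
IsF N m = IsMaximum (fProperty N) m

-- triples with coordinates in {1,…,n}, encoded as Fin n (shifted by one)
Triple : ℕ → Set
Triple n = Fin n × Fin n × Fin n

TwoLess : ∀ {n} → Triple n → Triple n → Set
TwoLess (a , b , c) (a' , b' , c') =
  ((a <ᶠ a') × (b <ᶠ b')) ⊎ ((a <ᶠ a') × (c <ᶠ c')) ⊎ ((b <ᶠ b') × (c <ᶠ c'))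

FProperty : ℕ → ℕ → Set
FProperty n M = Σ (List (Triple n)) λ L → AllPairs TwoLess L × length L ≡ M

IsFF : ℕ → ℕ → Set
IsFF n M = IsMaximum (FProperty n) M

-- Label each vertex v by the triple whose c-th coordinate is n - 1 - ℓ_c(v),
-- where ℓ_c(v) is the number of edges of a longest c-avoiding path starting at
-- v. Along an edge of colour x the two coordinates c ≠ x strictly increase, so
-- either some path of vertex-length n + 1 avoids a colour or the labels form a
-- valid sequence of N triples in [n]³. Conversely, a valid sequence colours the
-- edge i → j by a coordinate in which L_i < L_j may fail; a c-avoiding path is
-- then strictly increasing in coordinate c and so has at most n vertices. Hence
-- N ≤ F(n) iff f(N) ≤ n. For part (iii) one also needs n ≤ f(F(n)), which
-- follows from F(n + 1) ≥ F(n) + 1: prepend (1,1,1) to a valid sequence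
-- shifted up by one.
module Submission where

open import Defs
open import Data.Nat using (ℕ; suc; _≤_; _<_)
open import Data.Product using (_×_)
open import Function.Bundles using (_⇔_)
open import Relation.Binary.PropositionalEquality using (_≡_)

open import Data.Nat using (zero; _+_; _∸_; z≤n; s≤s; z<s; s<s; s≤s⁻¹; s<s⁻¹; _≤?_)
open import Data.Nat.Properties
  using ( ≤-refl; ≤-reflexive; ≤-trans; ≤-antisym; ≤-<-trans; n<1+n; 1+n≰n; m≤m+n
        ; +-monoʳ-<; ∸-monoʳ-<; m≤n⇒m⊓n≡m; ≰⇒>; ≮⇒≥; ≤⇒≯; <⇒≱ )
open import Data.Fin using (Fin; zero; suc; toℕ; fromℕ<; _≟_; _<?_) renaming (_<_ to _<ᶠ_)
open import Data.Fin.Properties using (any?; toℕ<n; toℕ-fromℕ<)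
open import Data.List using (List; []; _∷_; length; map; filter; take; tabulate; lookup; allFin)
open import Data.List.Properties using (length-map; length-take; length-tabulate)
open import Data.List.Extrema.Nat using (max; argmax-sel; xs≤max)
open import Data.List.Membership.Propositional.Properties
  using (∈-map⁺; ∈-map⁻; ∈-filter⁺; ∈-filter⁻; ∈-allFin; ∈-lookup)
open import Data.List.Relation.Unary.Linked using (Linked; []; [-]; _∷_)
import Data.List.Relation.Unary.Linked as Linked
import Data.List.Relation.Unary.Linked.Properties as Linked
open import Data.List.Relation.Unary.AllPairs using (AllPairs; _∷_)
import Data.List.Relation.Unary.AllPairs as AllPairs
import Data.List.Relation.Unary.AllPairs.Properties as AllPairs
import Data.List.Relation.Unary.All as All
import Data.List.Relation.Unary.All.Properties as All
open import Data.Product using (Σ-syntax; _,_; proj₁; proj₂)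
import Data.Product as Product
open import Data.Sum using (_⊎_; inj₁; inj₂; [_,_]′)
import Data.Sum as Sum
open import Data.Empty using (⊥-elim)
open import Function using (_∘_; id)
open import Function.Bundles using (mk⇔)
open import Relation.Nullary using (¬_; Dec; ¬?; yes; no; contradiction)
open import Relation.Binary.PropositionalEquality using (refl; sym; trans; cong; subst; subst₂; _≢_)

HasAvoidingPath : ∀ {N} → Colouring N → ℕ → Set
HasAvoidingPath {N} col m = Σ[ c ∈ Fin 3 ] Σ[ p ∈ List (Fin N) ] AvoidingPath col c p × m ≤ length p

coordinate : ∀ {n} → Fin 3 → Triple n → Fin n
coordinate zero             (a , _ , _) = a
coordinate (suc zero)       (_ , b , _) = b
coordinate (suc (suc zero)) (_ , _ , c) = c

triple : ∀ {n} → (Fin 3 → Fin n) → Triple n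
triple f = f zero , f (suc zero) , f (suc (suc zero))

TwoLess⇒allBut : ∀ {n} {s t : Triple n} → TwoLess s t →
  Σ[ c ∈ Fin 3 ] (∀ d → c ≢ d → coordinate d s <ᶠ coordinate d t)
TwoLess⇒allBut (inj₁ (a< , b<)) = suc (suc zero) ,
  λ { zero _ → a< ; (suc zero) _ → b< ; (suc (suc zero)) ne → ⊥-elim (ne refl) }
TwoLess⇒allBut (inj₂ (inj₁ (a< , c<))) = suc zero ,
  λ { zero _ → a< ; (suc zero) ne → ⊥-elim (ne refl) ; (suc (suc zero)) _ → c< }
TwoLess⇒allBut (inj₂ (inj₂ (b< , c<))) = zero ,
  λ { zero ne → ⊥-elim (ne refl) ; (suc zero) _ → b< ; (suc (suc zero)) _ → c< }

allBut⇒TwoLess : ∀ {n} {f g : Fin 3 → Fin n} c →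
  (∀ d → c ≢ d → f d <ᶠ g d) → TwoLess (triple f) (triple g)
allBut⇒TwoLess zero             inc = inj₂ (inj₂ (inc (suc zero) (λ ()) , inc (suc (suc zero)) (λ ())))
allBut⇒TwoLess (suc zero)       inc = inj₂ (inj₁ (inc zero (λ ()) , inc (suc (suc zero)) (λ ())))
allBut⇒TwoLess (suc (suc zero)) inc = inj₁ (inc zero (λ ()) , inc (suc zero) (λ ()))

tailColouring : ∀ {N} → Colouring (suc N) → Colouring N
tailColouring col i j = col (suc i) (suc j)

avoids₀? : ∀ {N} (col : Colouring (suc N)) c (w : Fin N) → Dec (col zero (suc w) ≢ c)
avoids₀? col c w = ¬? (col zero (suc w) ≟ c)

avoidingSuccessors : ∀ {N} → Colouring (suc N) → Fin 3 → List (Fin N)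
avoidingSuccessors {N} col c = filter (avoids₀? col c) (allFin N)

-- The number of edges of a longest c-avoiding path starting at a vertex.
longest : ∀ {N} → Colouring N → Fin 3 → Fin N → ℕ
longest {suc N} col c zero =
  max 0 (map (suc ∘ longest (tailColouring col) c) (avoidingSuccessors col c))
longest {suc N} col c (suc v) = longest (tailColouring col) c v

AvoidingPath-tail : ∀ {N} {col : Colouring (suc N)} {c} {xs} →
  AvoidingPath (tailColouring col) c xs → AvoidingPath col c (map suc xs)
AvoidingPath-tail path = Linked.map⁺ (Linked.map (Product.map₁ s<s) path)

longest-step : ∀ {N} (col : Colouring N) c {u v} →
  Step col c u v → longest col c v < longest col c u
longest-step {suc N} col c {zero} {suc w} (_ , avoids) =
  All.lookup (xs≤max 0 _) (∈-map⁺ _ (∈-filter⁺ (avoids₀? col c) (∈-allFin w) avoids))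
longest-step {suc N} col c {suc u} {suc v} (u<v , avoids) =
  longest-step (tailColouring col) c (s<s⁻¹ u<v , avoids)

longest-path : ∀ {N} (col : Colouring N) c v →
  Σ[ xs ∈ List (Fin N) ] AvoidingPath col c (v ∷ xs) × longest col c v ≤ length xs
longest-path {suc N} col c (suc v) with longest-path (tailColouring col) c v
... | xs , path , ℓ≤ =
  map suc xs , AvoidingPath-tail path , subst (_ ≤_) (sym (length-map suc xs)) ℓ≤
longest-path {suc N} col c zero
  with argmax-sel id 0 (map (suc ∘ longest (tailColouring col) c) (avoidingSuccessors col c))
... | inj₁ max≡0 = [] , [-] , ≤-reflexive max≡0
... | inj₂ max∈ with ∈-map⁻ _ max∈
...   | w , w∈ , max≡
  with ∈-filter⁻ (avoids₀? col c) {xs = allFin N} w∈ | longest-path (tailColouring col) c w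
...     | _ , avoids | ys , path , ℓ≤ =
  suc w ∷ map suc ys ,
  (z<s , avoids) ∷ AvoidingPath-tail path ,
  subst₂ _≤_ (sym max≡) (cong suc (sym (length-map suc ys))) (s≤s ℓ≤)

shortPaths⇒sequence : ∀ {N n} (col : Colouring N) →
  (∀ c v → longest col c v < n) → FProperty n N
shortPaths⇒sequence {N} {n} col short =
  tabulate label , AllPairs.tabulate⁺-< label-increasing , length-tabulate label
  where
  -- The coordinate is n ∸ suc (longest col c v), the value whose bound ∸-monoʳ-<
  -- provides; it grows along c-avoiding edges.
  level : Fin N → Fin 3 → Fin n
  level v c = fromℕ< (∸-monoʳ-< z<s (short c v))

  label : Fin N → Triple n
  label v = triple (level v)

  level-increasing : ∀ {c u v} → Step col c u v → level u c <ᶠ level v c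
  level-increasing {c} {u} step =
    subst₂ _<_ (sym (toℕ-fromℕ< _)) (sym (toℕ-fromℕ< _))
      (∸-monoʳ-< (s<s (longest-step col c step)) (short c u))

  label-increasing : ∀ {u v} → u <ᶠ v → TwoLess (label u) (label v)
  label-increasing {u} {v} u<v =
    allBut⇒TwoLess (col u v) (λ d avoids → level-increasing (u<v , avoids))

avoidingPath⊎sequence : ∀ {N} n (col : Colouring N) →
  HasAvoidingPath col (suc n) ⊎ FProperty n N
avoidingPath⊎sequence n col with any? (λ c → any? (λ v → n ≤? longest col c v))
... | yes (c , v , n≤ℓ) with longest-path col c v
...   | xs , path , ℓ≤ = inj₁ (c , v ∷ xs , path , s≤s (≤-trans n≤ℓ ℓ≤))
avoidingPath⊎sequence n col | no ¬long =
  inj₂ (shortPaths⇒sequence col λ c v → ≰⇒> λ n≤ℓ → ¬long (c , v , n≤ℓ))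

sequenceless⇒fProperty : ∀ {n N} → ¬ FProperty n N → fProperty N (suc n)
sequenceless⇒fProperty {n} ¬seq col = [ id , ⊥-elim ∘ ¬seq ]′ (avoidingPath⊎sequence n col)

AllPairs-lookup : ∀ {A : Set} {R : A → A → Set} {xs : List A} → AllPairs R xs →
  ∀ {i j} → i <ᶠ j → R (lookup xs i) (lookup xs j)
AllPairs-lookup {xs = _ ∷ xs} (Rx ∷ _) {zero} {suc j} _ = All.lookup Rx (∈-lookup {xs = xs} j)
AllPairs-lookup (_ ∷ pairs) {suc i} {suc j} i<j = AllPairs-lookup pairs (s<s⁻¹ i<j)

increasing-length< : ∀ {n} {x : Fin n} {xs} → Linked _<ᶠ_ (x ∷ xs) → length xs + toℕ x < n
increasing-length< [-] = toℕ<n _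
increasing-length< {xs = _ ∷ ys} (x<y ∷ increasing) =
  ≤-<-trans (+-monoʳ-< (length ys) x<y) (increasing-length< increasing)

increasing-length≤ : ∀ {n} {xs : List (Fin n)} → Linked _<ᶠ_ xs → length xs ≤ n
increasing-length≤ [] = z≤n
increasing-length≤ {xs = _ ∷ xs} increasing =
  ≤-trans (s≤s (m≤m+n (length xs) _)) (increasing-length< increasing)

module _ {n} (L : List (Triple n)) (valid : AllPairs TwoLess L) where

  -- The edge i → j gets a coordinate in which L_i < L_j may fail.
  sequenceColouring : Colouring (length L)
  sequenceColouring u v with u <? v
  ... | yes u<v = proj₁ (TwoLess⇒allBut (AllPairs-lookup valid u<v))
  ... | no _    = zero

  sequenceColouring-step : ∀ {c u v} → Step sequenceColouring c u v →
    coordinate c (lookup L u) <ᶠ coordinate c (lookup L v)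
  sequenceColouring-step {c} {u} {v} (u<v , avoids) with u <? v
  ... | yes u<v′ = proj₂ (TwoLess⇒allBut (AllPairs-lookup valid u<v′)) c avoids
  ... | no ¬u<v  = contradiction u<v ¬u<v

  sequenceColouring-short : ∀ c p → AvoidingPath sequenceColouring c p → length p ≤ n
  sequenceColouring-short c p path =
    subst (_≤ n) (length-map (coordinate c ∘ lookup L) p)
      (increasing-length≤ (Linked.map⁺ (Linked.map sequenceColouring-step path)))

FProperty-prefix : ∀ {n N M} → N ≤ M → FProperty n M → FProperty n N
FProperty-prefix {N = N} N≤M (L , valid , refl) =
  take N L , AllPairs.take⁺ N valid , trans (length-take N L) (m≤n⇒m⊓n≡m N≤M)

sequence⇒fProperty-≤ : ∀ {n N m} → FProperty n N → fProperty N m → m ≤ n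
sequence⇒fProperty-≤ (L , valid , refl) fP with fP (sequenceColouring L valid)
... | c , p , path , m≤ = ≤-trans m≤ (sequenceColouring-short L valid c p path)

shiftTriple : ∀ {n} → Triple n → Triple (suc n)
shiftTriple (a , b , c) = suc a , suc b , suc c

TwoLess-shift : ∀ {n} {s t : Triple n} → TwoLess s t → TwoLess (shiftTriple s) (shiftTriple t)
TwoLess-shift = Sum.map both (Sum.map both both)
  where
  both : ∀ {a b c d} → a < b × c < d → suc a < suc b × suc c < suc d
  both = Product.map s<s s<s

FProperty-suc : ∀ {n M} → FProperty n M → FProperty (suc n) (suc M)
FProperty-suc (L , valid , refl) =
  (zero , zero , zero) ∷ map shiftTriple L ,
  All.map⁺ (All.universal (λ _ → inj₁ (z<s , z<s)) L) ∷
    AllPairs.map⁺ (AllPairs.map TwoLess-shift valid) ,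
  cong suc (length-map shiftTriple L)

module _ {n N fN Fn : ℕ} (isF : IsF N fN) (isFF : IsFF n Fn) where

  F<⇒<f : Fn < N → n < fN
  F<⇒<f Fn<N = proj₂ isF (suc n) (sequenceless⇒fProperty (<⇒≱ Fn<N ∘ proj₂ isFF N))

  ≤F⇒f≤ : N ≤ Fn → fN ≤ n
  ≤F⇒f≤ N≤Fn = sequence⇒fProperty-≤ (FProperty-prefix N≤Fn (proj₁ isFF)) (proj₁ isF)

  f≤⇒≤F : fN ≤ n → N ≤ Fn
  f≤⇒≤F fN≤n = ≮⇒≥ (≤⇒≯ fN≤n ∘ F<⇒<f)

  <f⇒F< : n < fN → Fn < N
  <f⇒F< n<fN = ≰⇒> (<⇒≱ n<fN ∘ ≤F⇒f≤)

F≡⇒≤f : ∀ {n N fN} → 1 ≤ n → IsF N fN → IsFF n N → n ≤ fN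
F≡⇒≤f {suc m} {N} _ isF isFF =
  proj₂ isF (suc m) (sequenceless⇒fProperty (1+n≰n ∘ proj₂ isFF (suc N) ∘ FProperty-suc))

lemma1 : ∀ (n N : ℕ) → 1 ≤ n → 1 ≤ N →
    ∀ (fN fN+1 Fn : ℕ) → IsF N fN → IsF (suc N) fN+1 → IsFF n Fn →
    (fN ≤ n → N ≤ Fn) × (n < fN → Fn < N) × (Fn ≡ N ⇔ (fN ≡ n × n < fN+1))
lemma1 n N 1≤n _ fN fN+1 Fn isF isF′ isFF =
  f≤⇒≤F isF isFF , <f⇒F< isF isFF , mk⇔ to from
  where
  to : Fn ≡ N → fN ≡ n × n < fN+1
  to refl = ≤-antisym (≤F⇒f≤ isF isFF ≤-refl) (F≡⇒≤f 1≤n isF isFF) , F<⇒<f isF′ isFF (n<1+n Fn)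

  from : fN ≡ n × n < fN+1 → Fn ≡ N
  from (fN≡n , n<fN+1) =
    ≤-antisym (s≤s⁻¹ (<f⇒F< isF′ isFF n<fN+1)) (f≤⇒≤F isF isFF (≤-reflexive fN≡n))
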